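{- Let $\Gamma$ be a countable group, let $\Gamma\curvearrowright X$ be an action on a set, let $S\Subset\Gamma$, and let $n\in\mathbb N$. Then every $\Pi_{S,n}$-coloring of $X$ is an $S$-separated $n$-coloring. Moreover, if the action is free, then conversely every $S$-separated $n$-coloring of $X$ is a $\Pi_{S,n}$-coloring.
   Context: $S\Subset\Gamma$ means $S$ is a finite subset of $\Gamma$ with $1\in S$ and $S^{ -1}=S$. An $n$-coloring is a function whose image is a subset of $\{0,1,\dots,n-1\}$. A function $c$ with domain $X$ is $S$-separated if there is a uniform bound on the sizes of the connected components of the graph with vertex set $X$ in which $x,x'$ are adjacent iff $x'\in Sx$ and $c(x)=c(x')$. An LCL on $\Gamma$ is a set of functions each with a finite subset of $\Gamma$ as domain; for an LCL $\Pi$, a function $c$ with domain $X$ is a $\Pi$-coloring if there is a finite $\Pi_0\subseteq\Pi$ such that for every $x\in X$ there is $P\in\Pi_0$ with $c(\gamma x)=P(\gamma)$ for all $\gamma\in\operatorname{dom}(P)$. The LCL $\Pi_{S,n}$ is the set of all $n$-colorings $P$ such that (i) $\operatorname{dom}(P)$ is a finite subset of $\Gamma$, (ii) $1\in\operatorname{dom}(P)$, and (iii) for every $\gamma\in\operatorname{dom}(P)$ with $P(\gamma)=P(1)$, we have $S\gamma\subseteq\operatorname{dom}(P)$. -}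

module Defs where

open import Data.Nat using (ℕ; _<_; _≤_)
open import Data.List using (List; length)
open import Data.List.Membership.Propositional using (_∈_)
open import Data.List.Relation.Unary.Unique.Propositional using (Unique)
open import Data.List.Relation.Unary.All using (All)
open import Data.Product using (Σ; _×_)
open import Relation.Binary.PropositionalEquality using (_≡_)
open import Relation.Binary.Construct.Closure.ReflexiveTransitive using (Star)
open import Function.Definitions using (Injective)

Countable : Set → Set
Countable A = Σ (A → ℕ) λ f → Injective _≡_ _≡_ f

record IsAction {Γ : Set} (_∙_ : Γ → Γ → Γ) (ε : Γ) {X : Set} (_·_ : Γ → X → X) : Set where
  field
    identity : ∀ x → ε · x ≡ x
    compat   : ∀ g h x → (g ∙ h) · x ≡ g · (h · x)

IsFree : {Γ : Set} (ε : Γ) {X : Set} (_·_ : Γ → X → X) → Set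
IsFree {Γ} ε {X} _·_ = ∀ (g : Γ) (x : X) → g · x ≡ x → g ≡ ε

-- S ⋐ Γ : a finite subset (given as a list) containing 1 and closed under inverses.
IsSymFinSub : {Γ : Set} (ε : Γ) (_⁻¹ : Γ → Γ) → List Γ → Set
IsSymFinSub ε _⁻¹ S = (ε ∈ S) × (∀ {s} → s ∈ S → (s ⁻¹) ∈ S)

IsColoring : {X : Set} → ℕ → (X → ℕ) → Set
IsColoring {X} n c = ∀ (x : X) → c x < n

-- A function with a finite subset of Γ as domain: the domain is the (finite)
-- set of elements of the list 'dom'; only the values of 'val' on 'dom' matter.
record Pattern (Γ : Set) : Set where
  constructor mkPattern
  field
    dom : List Γ
    val : Γ → ℕ
open Pattern public

LCL : Set → Set₁
LCL Γ = Pattern Γ → Set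

ΠSn : {Γ : Set} (_∙_ : Γ → Γ → Γ) (ε : Γ) (S : List Γ) (n : ℕ) → LCL Γ
ΠSn _∙_ ε S n P =
  All (λ γ → val P γ < n) (dom P)
  × (ε ∈ dom P)
  × (∀ {γ} → γ ∈ dom P → val P γ ≡ val P ε → ∀ {s} → s ∈ S → (s ∙ γ) ∈ dom P)

IsΠColoring : {Γ X : Set} (_·_ : Γ → X → X) (Π : LCL Γ) (c : X → ℕ) → Set
IsΠColoring {Γ} {X} _·_ Π c =
  Σ (List (Pattern Γ)) λ Π₀ →
    All Π Π₀
    × (∀ (x : X) → Σ (Pattern Γ) λ P → (P ∈ Π₀) × (∀ {γ} → γ ∈ dom P → c (γ · x) ≡ val P γ))

Edge : {Γ X : Set} (_·_ : Γ → X → X) (S : List Γ) (c : X → ℕ) → X → X → Set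
Edge {Γ} _·_ S c x x' = (Σ Γ λ s → (s ∈ S) × (x' ≡ s · x)) × (c x ≡ c x')

-- c is S-separated: there is a uniform bound B on the sizes of the connected
-- components, i.e. every list of pairwise distinct points in the component of x
-- has length at most B.
IsSeparated : {Γ X : Set} (_·_ : Γ → X → X) (S : List Γ) (c : X → ℕ) → Set
IsSeparated {Γ} {X} _·_ S c =
  Σ ℕ λ B → ∀ (x : X) (ys : List X) → Unique ys →
    All (λ y → Star (Edge _·_ S c) x y) ys → length ys ≤ B

{-# OPTIONS --safe #-}
-- If c is a Π_{S,n}-coloring and P is the pattern seen from x, then the set of γ ∈ dom P with
-- c(γx) = c(x) contains 1 and is closed under left multiplication by S, so the component of x
-- lies in (dom P)·x and its size is bounded by the domain sizes of the finitely many patterns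
-- in use.
-- Conversely, let every component have at most B points and let the action be free, so that
-- γ ↦ γx is injective. The breadth-first exploration C₀ = {1},
-- C_{j+1} = C_j ∪ {sγ : s ∈ S, γ ∈ C_j, c(sγx) = c(x)} of the component of x then stops growing
-- at some k ≤ B, and the restriction of γ ↦ c(γx) to C_k ∪ S C_k satisfies Π_{S,n}. Its domain
-- lies in the ball of radius B + 1 of the word metric of S, so all these patterns come from one
-- finite list. Countability of Γ gives decidable equality, which makes the searches constructive.
module Submission where

open import Defs
open import Data.Nat using (ℕ)
open import Data.List using (List)
open import Data.Product using (_×_)
open import Relation.Binary.PropositionalEquality using (_≡_)
open import Algebra.Structures using (IsGroup)

open import Algebra.Bundles using (Group)
open import Data.Bool using (true; false)
open import Data.Empty using (⊥-elim)
open import Data.Fin using (Fin; zero; suc)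
open import Data.Fin.Properties using (injective⇒≤)
open import Data.List using ([]; _∷_; _++_; map; length; filter; cartesianProductWith; upTo; lookup)
open import Data.List.Membership.Propositional using (_∈_; find)
open import Data.List.Membership.Propositional.Properties
  using (∈-lookup; ∈-map⁺; ∈-++⁺ˡ; ∈-++⁺ʳ; ∈-++⁻; ∈-filter⁺; ∈-filter⁻;
         ∈-cartesianProductWith⁺; ∈-cartesianProductWith⁻; ∈-upTo⁺)
open import Data.List.Properties using (length-map)
open import Data.List.Relation.Binary.Subset.Propositional using (_⊆_)
open import Data.List.Relation.Binary.Subset.Propositional.Properties
  using (xs⊆xs++ys; ∈-∷⁺ʳ; ++⁺; filter-⊆)
open import Data.List.Relation.Unary.All as All using (All; []; _∷_; all?)
open import Data.List.Relation.Unary.All.Properties using (¬Any⇒All¬; ¬All⇒Any¬; all-filter)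
  renaming (map⁺ to All-map⁺)
open import Data.List.Relation.Unary.AllPairs using ([]; _∷_)
open import Data.List.Relation.Unary.Any as Any using (here; there)
open import Data.List.Relation.Unary.Any.Properties using (lookup-index)
open import Data.List.Relation.Unary.Unique.Propositional using (Unique)
import Data.List.Relation.Unary.Unique.Propositional.Properties as Unique
import Data.List.Membership.DecPropositional as DecMembership
open import Data.Nat using (suc; zero; _<_; _≤_; _≤′_; ≤′-refl; ≤′-step; _<?_)
open import Data.Nat.ListAction using (sum)
open import Data.Nat.Properties as ℕ using (≤-trans; m≤m+n; m≤n+m; n<1+n; m<n⇒m<1+n; ≤⇒≤′)
open import Data.Product using (∃; _,_; proj₁; proj₂)
open import Data.Sum using (_⊎_; inj₁; inj₂)
open import Function using (_∘_)
open import Function.Definitions using (Injective)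
open import Relation.Binary.Construct.Closure.ReflexiveTransitive using (Star; _◅_; _◅◅_)
  renaming (ε to ε*)
open import Relation.Binary.Definitions using (DecidableEquality)
open import Relation.Binary.PropositionalEquality using (refl; sym; trans; cong; subst; module ≡-Reasoning)
open import Relation.Nullary using (yes; no; does)
open import Relation.Nullary.Decidable using (_×-dec_; _→-dec_; map′)
open import Relation.Unary using (Decidable)

module _ {A : Set} where

  Unique⇒lookup-injective : ∀ {xs : List A} → Unique xs → Injective _≡_ _≡_ (lookup xs)
  Unique⇒lookup-injective (_ ∷ _)      {zero}  {zero}  _   = refl
  Unique⇒lookup-injective (x≢ ∷ _)     {zero}  {suc j} x≡  = ⊥-elim (All.lookup x≢ (∈-lookup j) x≡)
  Unique⇒lookup-injective (x≢ ∷ _)     {suc i} {zero}  ≡x  = ⊥-elim (All.lookup x≢ (∈-lookup i) (sym ≡x))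
  Unique⇒lookup-injective (_ ∷ unique) {suc i} {suc j} eq  = cong suc (Unique⇒lookup-injective unique eq)

  Unique∧⊆⇒length≤ : ∀ {xs ys : List A} → Unique xs → xs ⊆ ys → length xs ≤ length ys
  Unique∧⊆⇒length≤ {xs} {ys} unique xs⊆ys = injective⇒≤ position-injective
    where
    position : Fin (length xs) → Fin (length ys)
    position i = Any.index (xs⊆ys (∈-lookup i))
    position-injective : Injective _≡_ _≡_ position
    position-injective {i} {j} eq = Unique⇒lookup-injective unique (begin
      lookup xs i            ≡⟨ lookup-index (xs⊆ys (∈-lookup i)) ⟩
      lookup ys (position i) ≡⟨ cong (lookup ys) eq ⟩
      lookup ys (position j) ≡⟨ lookup-index (xs⊆ys (∈-lookup j)) ⟨
      lookup xs j            ∎)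
      where open ≡-Reasoning

  subsequences : List A → List (List A)
  subsequences []       = [] ∷ []
  subsequences (a ∷ as) = map (a ∷_) (subsequences as) ++ subsequences as

  filter∈subsequences : ∀ {P : A → Set} (P? : Decidable P) as → filter P? as ∈ subsequences as
  filter∈subsequences P? []       = here refl
  filter∈subsequences P? (a ∷ as) with does (P? a)
  ... | true  = ∈-++⁺ˡ (∈-map⁺ (a ∷_) (filter∈subsequences P? as))
  ... | false = ∈-++⁺ʳ _ (filter∈subsequences P? as)

  tuples : List A → ℕ → List (List A)
  tuples as zero    = [] ∷ []
  tuples as (suc m) = cartesianProductWith _∷_ as (tuples as m)

  map∈tuples : ∀ {B : Set} {f : B → A} {as bs} → All (λ b → f b ∈ as) bs → map f bs ∈ tuples as (length bs)
  map∈tuples []             = here refl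
  map∈tuples (fb∈as ∷ f∈as) = ∈-cartesianProductWith⁺ _∷_ fb∈as (map∈tuples f∈as)

∈⇒≤sum : ∀ {m ms} → m ∈ ms → m ≤ sum ms
∈⇒≤sum {ms = m ∷ ms} (here refl) = m≤m+n m (sum ms)
∈⇒≤sum {ms = m ∷ ms} (there m∈)  = ≤-trans (∈⇒≤sum m∈) (m≤n+m (sum ms) m)

Countable⇒DecidableEquality : ∀ {A : Set} → Countable A → DecidableEquality A
Countable⇒DecidableEquality (code , code-injective) a b = map′ code-injective (cong code) (code a ℕ.≟ code b)

module _ {A : Set} (_≟_ : DecidableEquality A) where
  open DecMembership _≟_ using (_∈?_)

  lookupTable : List A → List ℕ → A → ℕ
  lookupTable (a ∷ as) (v ∷ vs) b with b ≟ a
  ... | yes _ = v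
  ... | no _  = lookupTable as vs b
  lookupTable _ _ _ = 0

  lookupTable-map : ∀ (g : A → ℕ) {a} as → a ∈ as → lookupTable as (map g as) a ≡ g a
  lookupTable-map g {a} (b ∷ as) a∈ with a ≟ b
  lookupTable-map g (b ∷ as) a∈         | yes refl = refl
  lookupTable-map g (b ∷ as) (here a≡b) | no a≢b   = ⊥-elim (a≢b a≡b)
  lookupTable-map g (b ∷ as) (there a∈) | no _     = lookupTable-map g as a∈

  stabilises-or-grows : (L : ℕ → List A) → (∀ j → L j ⊆ L (suc j)) → ∀ m →
    (∃ λ k → k < m × L (suc k) ⊆ L k) ⊎ (∃ λ us → Unique us × us ⊆ L m × length us ≡ m)
  stabilises-or-grows L increasing zero = inj₂ ([] , [] , (λ ()) , refl)
  stabilises-or-grows L increasing (suc m) with stabilises-or-grows L increasing m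
  ... | inj₁ (k , k<m , stable) = inj₁ (k , m<n⇒m<1+n k<m , stable)
  ... | inj₂ (us , unique , us⊆ , refl) with all? (_∈? L m) (L (suc m))
  ...   | yes stable   = inj₁ (m , n<1+n m , All.lookup stable)
  ...   | no unstable with find (¬All⇒Any¬ (_∈? L m) (L (suc m)) unstable)
  ...     | u , u∈ , u∉ =
    inj₂ (u ∷ us , ¬Any⇒All¬ us (u∉ ∘ us⊆) ∷ unique , ∈-∷⁺ʳ u∈ (increasing m ∘ us⊆) , refl)

Star-Edge⇒same-color : ∀ {Γ X : Set} {_·_ : Γ → X → X} {S : List Γ} {c : X → ℕ} {x y} →
                       Star (Edge _·_ S c) x y → c x ≡ c y
Star-Edge⇒same-color ε*                  = refl
Star-Edge⇒same-color ((_ , cx≡cz) ◅ path) = trans cx≡cz (Star-Edge⇒same-color path)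

module _ {Γ : Set} (_≟_ : DecidableEquality Γ) (_∙_ : Γ → Γ → Γ) (ε : Γ) (S : List Γ) (n : ℕ) where
  open DecMembership _≟_ using (_∈?_)

  ΠSn? : Decidable (ΠSn _∙_ ε S n)
  ΠSn? (mkPattern D v) =
    all? (λ γ → v γ <? n) D ×-dec ε ∈? D ×-dec
    map′ fromAll toAll (all? (λ γ → v γ ℕ.≟ v ε →-dec all? (λ s → (s ∙ γ) ∈? D) S) D)
    where
    ClosedAll = All (λ γ → v γ ≡ v ε → All (λ s → (s ∙ γ) ∈ D) S) D
    Closed    = ∀ {γ} → γ ∈ D → v γ ≡ v ε → ∀ {s} → s ∈ S → (s ∙ γ) ∈ D
    fromAll : ClosedAll → Closed
    fromAll closed γ∈ same s∈ = All.lookup (All.lookup closed γ∈ same) s∈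
    toAll : Closed → ClosedAll
    toAll closed = All.tabulate λ γ∈ same → All.tabulate λ s∈ → closed γ∈ same s∈

module _ {Γ : Set} {_∙_ : Γ → Γ → Γ} {ε : Γ} {_⁻¹ : Γ → Γ} (isGroup : IsGroup _≡_ _∙_ ε _⁻¹)
         {X : Set} {_·_ : Γ → X → X} (act : IsAction _∙_ ε _·_) where
  open IsAction act
  open IsGroup isGroup using (inverseˡ)

  private
    group : Group _ _
    group = record { isGroup = isGroup }

  open import Algebra.Properties.Group group using (inverseˡ-unique; ⁻¹-injective)

  free⇒·-injective : IsFree ε _·_ → ∀ x → Injective _≡_ _≡_ (_· x)
  free⇒·-injective free x {γ} {δ} γx≡δx =
    sym (⁻¹-injective (inverseˡ-unique (δ ⁻¹) γ (free ((δ ⁻¹) ∙ γ) x fixes)))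
    where
    open ≡-Reasoning
    fixes : ((δ ⁻¹) ∙ γ) · x ≡ x
    fixes = begin
      ((δ ⁻¹) ∙ γ) · x ≡⟨ compat (δ ⁻¹) γ x ⟩
      (δ ⁻¹) · (γ · x) ≡⟨ cong ((δ ⁻¹) ·_) γx≡δx ⟩
      (δ ⁻¹) · (δ · x) ≡⟨ compat (δ ⁻¹) δ x ⟨
      ((δ ⁻¹) ∙ δ) · x ≡⟨ cong (_· x) (inverseˡ δ) ⟩
      ε · x            ≡⟨ identity x ⟩
      x                ∎

module _ {Γ X : Set} {_∙_ : Γ → Γ → Γ} {ε : Γ} {_·_ : Γ → X → X} (act : IsAction _∙_ ε _·_)
         (S : List Γ) (n : ℕ) {c : X → ℕ} where
  open IsAction act

  module _ {P : Pattern Γ} (P∈Π : ΠSn _∙_ ε S n P) {x : X}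
           (c≡P : ∀ {γ} → γ ∈ dom P → c (γ · x) ≡ val P γ) where

    private
      ε∈dom : ε ∈ dom P
      ε∈dom = proj₁ (proj₂ P∈Π)

    color≡val-ε : c x ≡ val P ε
    color≡val-ε = trans (cong c (sym (identity x))) (c≡P ε∈dom)

    color<n : c x < n
    color<n = subst (_< n) (sym color≡val-ε) (All.lookup (proj₁ P∈Π) ε∈dom)

    component⊆orbit : ∀ {y} → Star (Edge _·_ S c) x y → y ∈ map (_· x) (dom P)
    component⊆orbit = reach ε∈dom (sym (identity x)) refl
      where
      closed : ∀ {γ} → γ ∈ dom P → c (γ · x) ≡ c x → ∀ {s} → s ∈ S → (s ∙ γ) ∈ dom P
      closed γ∈ cγ = proj₂ (proj₂ P∈Π) γ∈ (trans (sym (c≡P γ∈)) (trans cγ color≡val-ε))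

      reach : ∀ {γ z y} → γ ∈ dom P → z ≡ γ · x → c z ≡ c x → Star (Edge _·_ S c) z y →
              y ∈ map (_· x) (dom P)
      reach γ∈ refl _ ε*                                          = ∈-map⁺ (_· x) γ∈
      reach {γ} γ∈ refl cγ (((s , s∈S , refl) , cγx≡csγx) ◅ path) =
        reach (closed γ∈ cγ s∈S) (sym (compat s γ x)) (trans (sym cγx≡csγx) cγ) path

  ΠSn-coloring⇒coloring : IsΠColoring _·_ (ΠSn _∙_ ε S n) c → IsColoring n c
  ΠSn-coloring⇒coloring (Π₀ , Π₀⊆Π , seen) x with seen x
  ... | P , P∈Π₀ , c≡P = color<n (All.lookup Π₀⊆Π P∈Π₀) c≡P

  ΠSn-coloring⇒separated : IsΠColoring _·_ (ΠSn _∙_ ε S n) c → IsSeparated _·_ S c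
  ΠSn-coloring⇒separated (Π₀ , Π₀⊆Π , seen) = sum (map (length ∘ dom) Π₀) , bounded
    where
    bounded : ∀ x ys → Unique ys → All (Star (Edge _·_ S c) x) ys → length ys ≤ sum (map (length ∘ dom) Π₀)
    bounded x ys unique reachable with seen x
    ... | P , P∈Π₀ , c≡P = begin
      length ys                   ≤⟨ Unique∧⊆⇒length≤ unique
                                       (component⊆orbit (All.lookup Π₀⊆Π P∈Π₀) c≡P ∘ All.lookup reachable) ⟩
      length (map (_· x) (dom P)) ≡⟨ length-map (_· x) (dom P) ⟩
      length (dom P)              ≤⟨ ∈⇒≤sum (∈-map⁺ (length ∘ dom) P∈Π₀) ⟩
      sum (map (length ∘ dom) Π₀) ∎
      where open ℕ.≤-Reasoning

module Balls {Γ : Set} (_∙_ : Γ → Γ → Γ) (ε : Γ) (S : List Γ) where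

  _⊙_ : List Γ → List Γ → List Γ
  K ⊙ L = cartesianProductWith _∙_ K L

  ⊙-monoʳ : ∀ K {L M} → L ⊆ M → K ⊙ L ⊆ K ⊙ M
  ⊙-monoʳ K {L} L⊆M γ∈ with ∈-cartesianProductWith⁻ _∙_ K L γ∈
  ... | _ , _ , s∈K , δ∈L , refl = ∈-cartesianProductWith⁺ _∙_ s∈K (L⊆M δ∈L)

  ball : ℕ → List Γ
  ball zero    = ε ∷ []
  ball (suc j) = ball j ++ S ⊙ ball j

  ball-mono : ∀ {j k} → j ≤ k → ball j ⊆ ball k
  ball-mono = ball-mono′ ∘ ≤⇒≤′
    where
    ball-mono′ : ∀ {j k} → j ≤′ k → ball j ⊆ ball k
    ball-mono′ ≤′-refl         γ∈ = γ∈
    ball-mono′ (≤′-step j≤′k) γ∈ = ∈-++⁺ˡ (ball-mono′ j≤′k γ∈)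

module _ {Γ : Set} (_≟_ : DecidableEquality Γ) where

  restriction : (W : List Γ) {D : Γ → Set} → Decidable D → (Γ → ℕ) → Pattern Γ
  restriction W D? g = mkPattern (filter D? W) (lookupTable _≟_ W (map g W))

  patternsOver : List Γ → ℕ → List (Pattern Γ)
  patternsOver W n =
    cartesianProductWith mkPattern (subsequences W) (map (lookupTable _≟_ W) (tuples (upTo n) (length W)))

  restriction∈patternsOver : ∀ {W n} {D : Γ → Set} (D? : Decidable D) {g : Γ → ℕ} →
                             All (λ w → g w < n) W → restriction W D? g ∈ patternsOver W n
  restriction∈patternsOver {W} D? g<n =
    ∈-cartesianProductWith⁺ mkPattern (filter∈subsequences D? W)
      (∈-map⁺ (lookupTable _≟_ W) (map∈tuples (All.map ∈-upTo⁺ g<n)))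

module _ {Γ : Set} {_∙_ : Γ → Γ → Γ} {ε : Γ} {_⁻¹ : Γ → Γ} (isGroup : IsGroup _≡_ _∙_ ε _⁻¹)
         (_≟_ : DecidableEquality Γ) {X : Set} {_·_ : Γ → X → X} (act : IsAction _∙_ ε _·_)
         (free : IsFree ε _·_) (S : List Γ) (n : ℕ) {c : X → ℕ} (coloring : IsColoring n c)
         (separated : IsSeparated _·_ S c) where
  open IsAction act
  open Balls _∙_ ε S
  open DecMembership _≟_ using (_∈?_)

  private
    B : ℕ
    B = proj₁ separated

    W : List Γ
    W = ball (suc B)

    Π₀ : List (Pattern Γ)
    Π₀ = filter (ΠSn? _≟_ _∙_ ε S n) (patternsOver _≟_ W n)

  module Exploration (x : X) where

    sameColor? : Decidable (λ γ → c (γ · x) ≡ c x)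
    sameColor? γ = c (γ · x) ℕ.≟ c x

    layer : ℕ → List Γ
    layer zero    = ε ∷ []
    layer (suc j) = layer j ++ filter sameColor? (S ⊙ layer j)

    ε∈layer : ∀ j → ε ∈ layer j
    ε∈layer zero    = here refl
    ε∈layer (suc j) = ∈-++⁺ˡ (ε∈layer j)

    layer⊆ball : ∀ j → layer j ⊆ ball j
    layer⊆ball zero    γ∈ = γ∈
    layer⊆ball (suc j)    = ++⁺ (layer⊆ball j) (⊙-monoʳ S (layer⊆ball j) ∘ filter-⊆ sameColor? _)

    layer-reachable : ∀ j {γ} → γ ∈ layer j → Star (Edge _·_ S c) x (γ · x)
    layer-reachable zero (here refl) = subst (Star (Edge _·_ S c) x) (sym (identity x)) ε*
    layer-reachable (suc j) γ∈ with ∈-++⁻ (layer j) γ∈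
    ... | inj₁ old = layer-reachable j old
    ... | inj₂ new with ∈-filter⁻ sameColor? new
    ...   | γ∈S⊙layer , cγ with ∈-cartesianProductWith⁻ _∙_ S (layer j) γ∈S⊙layer
    ...     | s , δ , s∈S , δ∈ , refl = path ◅◅ (step ◅ ε*)
      where
      path : Star (Edge _·_ S c) x (δ · x)
      path = layer-reachable j δ∈
      step : Edge _·_ S c (δ · x) ((s ∙ δ) · x)
      step = (s , s∈S , compat s δ x) , trans (sym (Star-Edge⇒same-color path)) (sym cγ)

    -- Growth at each of the first B + 1 steps would put B + 1 distinct points into the component of x.
    layer-stabilises : ∃ λ k → k < suc B × layer (suc k) ⊆ layer k
    layer-stabilises with stabilises-or-grows _≟_ layer (λ j → xs⊆xs++ys (layer j) _) (suc B)
    ... | inj₁ stable = stable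
    ... | inj₂ (us , unique , us⊆ , |us|≡1+B) = ⊥-elim (ℕ.1+n≰n (begin
      suc B                  ≡⟨ |us|≡1+B ⟨
      length us              ≡⟨ length-map (_· x) us ⟨
      length (map (_· x) us) ≤⟨ proj₂ separated x (map (_· x) us)
                                  (Unique.map⁺ (free⇒·-injective isGroup act free x) unique)
                                  (All-map⁺ (All.tabulate (layer-reachable (suc B) ∘ us⊆))) ⟩
      B                      ∎))
      where open ℕ.≤-Reasoning

    k : ℕ
    k = proj₁ layer-stabilises

    domain : List Γ
    domain = layer k ++ S ⊙ layer k

    domain⊆W : domain ⊆ W
    domain⊆W = ball-mono (proj₁ (proj₂ layer-stabilises)) ∘ ++⁺ (layer⊆ball k) (⊙-monoʳ S (layer⊆ball k))

    domain-closed : ∀ {γ} → γ ∈ domain → c (γ · x) ≡ c x → ∀ {s} → s ∈ S → (s ∙ γ) ∈ domain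
    domain-closed {γ} γ∈ cγ s∈S = ∈-++⁺ʳ (layer k) (∈-cartesianProductWith⁺ _∙_ s∈S γ∈layer)
      where
      γ∈layer : γ ∈ layer k
      γ∈layer with ∈-++⁻ (layer k) γ∈
      ... | inj₁ old = old
      ... | inj₂ new = proj₂ (proj₂ layer-stabilises) (∈-++⁺ʳ (layer k) (∈-filter⁺ sameColor? new cγ))

    localPattern : Pattern Γ
    localPattern = restriction _≟_ W (_∈? domain) (λ γ → c (γ · x))

    localPattern-agrees : ∀ {γ} → γ ∈ dom localPattern → c (γ · x) ≡ val localPattern γ
    localPattern-agrees γ∈ =
      sym (lookupTable-map _≟_ (λ γ → c (γ · x)) W (proj₁ (∈-filter⁻ (_∈? domain) {xs = W} γ∈)))

    dom-localPattern⊆domain : dom localPattern ⊆ domain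
    dom-localPattern⊆domain = proj₂ ∘ ∈-filter⁻ (_∈? domain) {xs = W}

    domain⊆dom-localPattern : domain ⊆ dom localPattern
    domain⊆dom-localPattern γ∈ = ∈-filter⁺ (_∈? domain) (domain⊆W γ∈) γ∈

    localPattern∈ΠSn : ΠSn _∙_ ε S n localPattern
    localPattern∈ΠSn =
      All.tabulate (λ γ∈ → subst (_< n) (localPattern-agrees γ∈) (coloring _)) ,
      ε∈dom ,
      λ γ∈ same s∈S → domain⊆dom-localPattern (domain-closed (dom-localPattern⊆domain γ∈) (color γ∈ same) s∈S)
      where
      ε∈dom : ε ∈ dom localPattern
      ε∈dom = domain⊆dom-localPattern (∈-++⁺ˡ (ε∈layer k))
      color : ∀ {γ} → γ ∈ dom localPattern → val localPattern γ ≡ val localPattern ε → c (γ · x) ≡ c x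
      color {γ} γ∈ same = begin
        c (γ · x)          ≡⟨ localPattern-agrees γ∈ ⟩
        val localPattern γ ≡⟨ same ⟩
        val localPattern ε ≡⟨ localPattern-agrees ε∈dom ⟨
        c (ε · x)          ≡⟨ cong c (identity x) ⟩
        c x                ∎
        where open ≡-Reasoning

    localPattern∈Π₀ : localPattern ∈ Π₀
    localPattern∈Π₀ = ∈-filter⁺ (ΠSn? _≟_ _∙_ ε S n)
      (restriction∈patternsOver _≟_ {W} (_∈? domain) (All.tabulate (λ _ → coloring _))) localPattern∈ΠSn

  separated⇒ΠSn-coloring : IsΠColoring _·_ (ΠSn _∙_ ε S n) c
  separated⇒ΠSn-coloring =
    Π₀ , all-filter (ΠSn? _≟_ _∙_ ε S n) (patternsOver _≟_ W n) ,
    λ x → Exploration.localPattern x , Exploration.localPattern∈Π₀ x , Exploration.localPattern-agrees x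

proposition4p7 :
    (Γ : Set) (_∙_ : Γ → Γ → Γ) (ε : Γ) (_⁻¹ : Γ → Γ) →
    IsGroup _≡_ _∙_ ε _⁻¹ → Countable Γ →
    (X : Set) (_·_ : Γ → X → X) → IsAction _∙_ ε _·_ →
    (S : List Γ) → IsSymFinSub ε _⁻¹ S → (n : ℕ) →
    ((c : X → ℕ) → IsΠColoring _·_ (ΠSn _∙_ ε S n) c →
        IsColoring n c × IsSeparated _·_ S c)
    × (IsFree ε _·_ → (c : X → ℕ) → IsColoring n c → IsSeparated _·_ S c →
        IsΠColoring _·_ (ΠSn _∙_ ε S n) c)
proposition4p7 Γ _∙_ ε _⁻¹ isGroup countable X _·_ act S _ n =
  (λ _ Π-coloring → ΠSn-coloring⇒coloring act S n Π-coloring , ΠSn-coloring⇒separated act S n Π-coloring) ,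
  (λ free _ → separated⇒ΠSn-coloring isGroup (Countable⇒DecidableEquality countable) act free S n)
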